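{- Let $(A,k)$ be an instance of \textsc{Unary Bin Packing} with $A=\{a_1,\dots,a_n\}$ and $B=\sum_{j\in[n]}a_j/k\in\mathbb N$, and let $(G,b)$ be the instance of \textsc{Bandwidth} constructed from it as described in the context. If $(G,b)$ is a YES-instance of \textsc{Bandwidth}, then $(A,k)$ is a YES-instance of \textsc{Unary Bin Packing}.
   Context: \textsc{Unary Bin Packing}: given non-negative integers $A=\{a_1,\dots,a_n\}$ (encoded in unary) and $k\in\mathbb N$, decide whether there is a partition $(S_1,\dots,S_k)$ of $A$ with $\sum_{a_j\in S_i}a_j=\sum_{j\in[n]}a_j/k$ for every $i\in[k]$. An ordering of a graph $G$ is a bijection $\pi:V(G)\to[|V(G)|]$ with stretch $\max_{\{u,v\}\in E(G)}|\pi(u)-\pi(v)|$; $(G,b)$ is a YES-instance of \textsc{Bandwidth} if some ordering has stretch at most $b$. $[x,y]=\{x,\dots,y\}$, $[x]=[1,x]$. Construction: set $b=2kB+B-1$. (1) Boundary cliques: a clique $X$ on $x_1,\dots,x_{2kB+B}$ and a clique $Y$ on $y_1,\dots,y_{2kB+B}$. Let $X^i=\{x_{2iB-B+2},\dots,x_{2iB+B+1}\}$ for $i\in[k-1]$ and $X^k=\{x_{2kB-B+2},\dots,x_{2kB+B}\}$; let $Y^1=\{y_1,\dots,y_{3B-1}\}$ and $Y^i=\{y_{2iB-B},\dots,y_{2iB+B-1}\}$ for $i\in[2,k]$. (2) Delimiter cliques: for each $i\in[k]$ a clique on $L^i\cup R^i$ where $L^i=\{\ell^i_1,\dots,\ell^i_B\}$,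 $R^i=\{r^i_1,\dots,r^i_B\}$. Add edges: $\ell^i_1$ to every $x\in\bigcup_{j=i}^kX^j$ (for each $i\in[k]$); $x_{2iB+B+1}$ to every vertex of $L^i$ (for $i\in[k-1]$); $x_{2kB+B}$ to every vertex of $L^k$; $r^i_B$ to every $y\in\bigcup_{j=1}^iY^j$ (for each $i\in[k]$); $y_{2iB-B}$ to every vertex of $R^i$ (for $i\in[2,k]$); $y_1$ to every vertex of $R^1$. (3) Item cliques: for each $j\in[n]$ a clique $A^j$ on $A^{j,L}\cup A^{j,R}$ with $A^{j,L}=\{a^{j,L}_1,\dots,a^{j,L}_{a_j}\}$, $A^{j,R}=\{a^{j,R}_1,\dots,a^{j,R}_{a_j}\}$; add edges from $x_{2kB+B}$ to every vertex of $\bigcup_{j\in[n]}A^{j,L}$ and from $y_1$ to every vertex of $\bigcup_{j\in[n]}A^{j,R}$. There are no other vertices or edges. -}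

module Defs where

open import Data.Nat using (ℕ; zero; suc; _+_; _*_; _∸_; _≤_; _<_; ∣_-_∣)
open import Data.Fin using (Fin; toℕ)
open import Data.Fin.Properties using (_≟_)
open import Data.List using (List; map; filter)
open import Data.Nat.ListAction using (sum)
open import Data.List.Base using (allFin)
open import Data.Product using (Σ; ∃; _×_; _,_)
open import Data.Sum using (_⊎_)
open import Relation.Binary.PropositionalEquality using (_≡_; _≢_)
open import Function.Bundles using (_⤖_; Bijection)

-- Unary Bin Packing
-- The multiset A = {a_1,…,a_n} is an indexed family a : Fin n → ℕ.

total : (n : ℕ) → (Fin n → ℕ) → ℕ
total n a = sum (map a (allFin n))

binSum : (n k : ℕ) → (Fin n → ℕ) → (Fin n → Fin k) → Fin k → ℕ
binSum n k a f i = sum (map a (filter (λ j → f j ≟ i) (allFin n)))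

-- (A,k) is a YES-instance: a partition (S_1,…,S_k) of A (given as the
-- assignment j ↦ bin of a_j) with every bin summing to (Σ a_j)/k,
-- written here as  k * binSum ≡ total  (no division needed).
BinPackingYes : (n : ℕ) → (Fin n → ℕ) → (k : ℕ) → Set
BinPackingYes n a k =
  ∃ λ (f : Fin n → Fin k) → ∀ (i : Fin k) → k * binSum n k a f i ≡ total n a

-- An ordering is a bijection V → [|V|] (here V ⤖ Fin N; N is then
-- necessarily |V|), positions 1..N are represented by Fin N (0-based,
-- which does not change differences).
StretchAtMost : {V : Set} (E : V → V → Set) {N : ℕ} → (V ⤖ Fin N) → ℕ → Set
StretchAtMost E π b =
  ∀ u v → E u v → ∣ toℕ (Bijection.to π u) - toℕ (Bijection.to π v) ∣ ≤ b

BandwidthYes : (V : Set) (E : V → V → Set) (b : ℕ) → Set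
BandwidthYes V E b = Σ ℕ λ N → Σ (V ⤖ Fin N) λ π → StretchAtMost E π b

pos : {m : ℕ} → Fin m → ℕ
pos i = suc (toℕ i)

size : (k B : ℕ) → ℕ
size k B = 2 * k * B + B

bound : (k B : ℕ) → ℕ
bound k B = 2 * k * B + B ∸ 1

data Side : Set where
  left right : Side

-- Vertices:
--   x m      : x_{m+1}, m ∈ Fin (2kB+B)
--   y m      : y_{m+1}
--   d left i p  : ℓ^{i+1}_{p+1},  d right i p : r^{i+1}_{p+1}
--   it left j p : a^{j+1,L}_{p+1}, it right j p : a^{j+1,R}_{p+1}
data Vtx (n : ℕ) (a : Fin n → ℕ) (k B : ℕ) : Set where
  x  : Fin (size k B) → Vtx n a k B
  y  : Fin (size k B) → Vtx n a k B
  d  : Side → Fin k → Fin B → Vtx n a k B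
  it : Side → (j : Fin n) → Fin (a j) → Vtx n a k B

-- m ∈ X^i  (i, m 1-based; 1 ≤ i ≤ k)
InX : (k B : ℕ) → ℕ → ℕ → Set
InX k B i m =
    (i < k × 2 * i * B ∸ B + 2 ≤ m × m ≤ 2 * i * B + B + 1)
  ⊎ (i ≡ k × 2 * k * B ∸ B + 2 ≤ m × m ≤ 2 * k * B + B)

-- m ∈ Y^i  (i, m 1-based; 1 ≤ i ≤ k)
InY : (k B : ℕ) → ℕ → ℕ → Set
InY k B i m =
    (i ≡ 1 × 1 ≤ m × m ≤ 3 * B ∸ 1)
  ⊎ (2 ≤ i × 2 * i * B ∸ B ≤ m × m ≤ 2 * i * B + B ∸ 1)

InXFrom : (k B : ℕ) → ℕ → ℕ → Set
InXFrom k B i m = ∃ λ j → i ≤ j × j ≤ k × InX k B j m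

InYUpTo : (k B : ℕ) → ℕ → ℕ → Set
InYUpTo k B i m = ∃ λ j → 1 ≤ j × j ≤ i × InY k B j m

-- Edges of G (each listed in one direction; stretch is symmetric).
data Edge (n : ℕ) (a : Fin n → ℕ) (k B : ℕ) : Vtx n a k B → Vtx n a k B → Set where
  xx : (m m' : Fin (size k B)) → m ≢ m' → Edge n a k B (x m) (x m')
  yy : (m m' : Fin (size k B)) → m ≢ m' → Edge n a k B (y m) (y m')
  dd : (i : Fin k) (s t : Side) (p q : Fin B) →
       d {n} {a} s i p ≢ d t i q → Edge n a k B (d s i p) (d t i q)
  l1x : (i : Fin k) (p : Fin B) (m : Fin (size k B)) → toℕ p ≡ 0 →
        InXFrom k B (pos i) (pos m) → Edge n a k B (d left i p) (x m)
  xL : (i : Fin k) (p : Fin B) (m : Fin (size k B)) → pos i < k →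
       pos m ≡ 2 * pos i * B + B + 1 → Edge n a k B (x m) (d left i p)
  xLk : (i : Fin k) (p : Fin B) (m : Fin (size k B)) → pos i ≡ k →
        pos m ≡ 2 * k * B + B → Edge n a k B (x m) (d left i p)
  rBy : (i : Fin k) (p : Fin B) (m : Fin (size k B)) → pos p ≡ B →
        InYUpTo k B (pos i) (pos m) → Edge n a k B (d right i p) (y m)
  yR : (i : Fin k) (p : Fin B) (m : Fin (size k B)) → 2 ≤ pos i →
       pos m ≡ 2 * pos i * B ∸ B → Edge n a k B (y m) (d right i p)
  yR1 : (i : Fin k) (p : Fin B) (m : Fin (size k B)) → pos i ≡ 1 →
        pos m ≡ 1 → Edge n a k B (y m) (d right i p)
  aa : (j : Fin n) (s t : Side) (p q : Fin (a j)) →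
       it {n} {a} {k} {B} s j p ≢ it t j q → Edge n a k B (it s j p) (it t j q)
  xA : (j : Fin n) (p : Fin (a j)) (m : Fin (size k B)) →
       pos m ≡ 2 * k * B + B → Edge n a k B (x m) (it left j p)
  yA : (j : Fin n) (p : Fin (a j)) (m : Fin (size k B)) →
       pos m ≡ 1 → Edge n a k B (y m) (it right j p)

{-# OPTIONS --safe #-}
-- In an ordering of stretch b = 2kB + B - 1 each of the cliques X and Y, having b + 1 vertices,
-- fills a window of b + 1 consecutive positions; reversing the ordering if necessary, X comes first.
-- Every delimiter and item clique has a vertex adjacent to x_{2kB+B} and one adjacent to y_1, which
-- forces all 4kB of their vertices strictly between the two windows.  The edges from ℓ^i_1 into
-- X^i ∪ … ∪ X^k and from r^i_B into Y^1 ∪ … ∪ Y^i then confine the i-th delimiter clique to a window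
-- of its own.  Counting the vertices able to occupy the first 2tB + B positions of the gap shows that
-- the items with a left vertex there weigh at least (t + 1)B; counting those able to occupy the last
-- 2(k - t - 1)B positions shows that the items with a right vertex there weigh at least (k - t - 1)B;
-- no item is of both kinds, as its two halves are within distance b.  So the items reaching into the
-- first 2tB + B positions weigh exactly (t + 1)B, and the successive differences of this increasing
-- chain of item sets are the k bins.
module Submission where

open import Defs
open import Data.Nat using (ℕ; zero; suc; _+_; _*_; _∸_; _≤_; _<_; z≤n; s≤s; _≤?_; _<?_)
open import Data.Nat.Properties
open import Data.Nat.ListAction using (sum)
open import Data.Nat.Tactic.RingSolver using (solve-∀)
open import Algebra.Properties.CommutativeSemigroup +-commutativeSemigroup using (interchange)
open import Data.Bool using (Bool; true; false; if_then_else_)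
open import Data.Fin using (Fin; zero; suc; toℕ; fromℕ; fromℕ<)
open import Data.Fin.Properties using (toℕ-fromℕ; toℕ-fromℕ<; toℕ<n; toℕ-injective; any?) renaming (_≟_ to _≟ᶠ_)
open import Data.List using (List; []; _∷_; _++_; length; map; filter; upTo; concatMap; allFin)
open import Data.List.Properties
  using (length-map; length-removeAt′; length-upTo; length-++; length-tabulate; map-cong)
open import Data.List.Relation.Unary.Any using (here; there; index; _─_)
open import Data.List.Relation.Unary.All using (lookup; universal)
import Data.List.Relation.Unary.All.Properties as All
import Data.List.Relation.Unary.AllPairs as AllPairs
import Data.List.Relation.Unary.AllPairs.Properties as AllPairs
open import Data.List.Relation.Unary.All.Properties using (¬Any⇒All¬)
open import Data.List.Relation.Unary.AllPairs using ([]; _∷_)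
open import Data.List.Relation.Unary.Unique.Propositional using (Unique)
open import Data.List.Relation.Unary.Unique.Propositional.Properties
  using (map⁺; upTo⁺; concat⁺; allFin⁺; filter⁺; ++⁺)
open import Data.List.Membership.Propositional using (_∈_; find; lose)
open import Data.List.Membership.Propositional.Properties
  using ( ∈-map⁺; ∈-map⁻; ∈-upTo⁺; ∈-upTo⁻; ∈-filter⁺; ∈-filter⁻; ∈-++⁺ˡ; ∈-++⁺ʳ; ∈-++⁻
        ; ∈-concatMap⁺; ∈-concatMap⁻; ∈-allFin)
open import Data.List.Relation.Binary.Subset.Propositional using (_⊆_)
open import Data.List.Extrema ≤-totalOrder using (argmin; f[argmin]≤f[xs])
open import Data.Product using (∃; _×_; _,_; proj₁; proj₂)
open import Data.Sum using (inj₁; inj₂)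
open import Data.Empty using (⊥; ⊥-elim)
open import Function using (_∘_; id)
open import Function.Bundles using (Bijection)
open import Relation.Nullary using (Dec; yes; no; does)
open import Relation.Nullary.Decidable using (map′; dec-true)
open import Relation.Binary.Definitions using (DecidableEquality; tri<; tri≈; tri>)
open import Relation.Binary.PropositionalEquality
  using (_≡_; _≢_; refl; sym; trans; cong; cong₂; subst; subst₂; module ≡-Reasoning)

-- Counting duplicate-free lists

module _ {A : Set} where

  ∈-─ : ∀ {u w : A} {ws} (u∈ws : u ∈ ws) → w ∈ ws → w ≢ u → w ∈ (ws ─ u∈ws)
  ∈-─ (here refl)  (here refl)  w≢u = ⊥-elim (w≢u refl)
  ∈-─ (here _)     (there w∈ws) _   = w∈ws
  ∈-─ (there _)    (here refl)  _   = here refl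
  ∈-─ (there u∈ws) (there w∈ws) w≢u = there (∈-─ u∈ws w∈ws w≢u)

  Unique-⊆⇒length≤ : ∀ {vs ws : List A} → Unique vs → vs ⊆ ws → length vs ≤ length ws
  Unique-⊆⇒length≤ {[]}     _            _     = z≤n
  Unique-⊆⇒length≤ {v ∷ vs} {ws} (v∉vs ∷ u) v∷vs⊆ws =
    subst (suc (length vs) ≤_) (sym (length-removeAt′ ws (index v∈ws)))
      (s≤s (Unique-⊆⇒length≤ u (λ z∈vs → ∈-─ v∈ws (v∷vs⊆ws (there z∈vs)) (λ z≡v → lookup v∉vs z∈vs (sym z≡v)))))
    where v∈ws = v∷vs⊆ws (here refl)

module _ {A : Set} (_≟_ : DecidableEquality A) where

  open import Data.List.Membership.DecPropositional _≟_ using (_∈?_)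

  Unique-⊆-length≥⇒⊇ : ∀ {vs ws : List A} → Unique vs → vs ⊆ ws → length ws ≤ length vs → ws ⊆ vs
  Unique-⊆-length≥⇒⊇ {vs} {ws} u vs⊆ws |ws|≤|vs| {w} w∈ws with w ∈? vs
  ... | yes w∈vs = w∈vs
  ... | no  w∉vs = ⊥-elim (<-irrefl refl (≤-trans (Unique-⊆⇒length≤ (¬Any⇒All¬ vs w∉vs ∷ u) w∷vs⊆ws) |ws|≤|vs|))
    where
    w∷vs⊆ws : w ∷ vs ⊆ ws
    w∷vs⊆ws (here refl)  = w∈ws
    w∷vs⊆ws (there z∈vs) = vs⊆ws z∈vs

length-allFin : ∀ m → length (allFin m) ≡ m
length-allFin m = length-tabulate id

length-map-allFin : ∀ {A : Set} {m} (f : Fin m → A) → length (map f (allFin m)) ≡ m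
length-map-allFin {m = m} f = trans (length-map f (allFin m)) (length-allFin m)

interval : ℕ → ℕ → List ℕ
interval lo len = map (lo +_) (upTo len)

length-interval : ∀ lo len → length (interval lo len) ≡ len
length-interval lo len = trans (length-map (lo +_) (upTo len)) (length-upTo len)

interval-Unique : ∀ lo len → Unique (interval lo len)
interval-Unique lo len = map⁺ (+-cancelˡ-≡ lo _ _) (upTo⁺ len)

∈-interval⁺ : ∀ {lo len w} → lo ≤ w → w < lo + len → w ∈ interval lo len
∈-interval⁺ {lo} {len} {w} lo≤w w<lo+len =
  subst (_∈ interval lo len) (m+[n∸m]≡n lo≤w)
    (∈-map⁺ (lo +_) (∈-upTo⁺ (+-cancelˡ-< lo _ _ (subst (_< lo + len) (sym (m+[n∸m]≡n lo≤w)) w<lo+len))))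

∈-interval⁻ : ∀ {lo len w} → w ∈ interval lo len → lo ≤ w × w < lo + len
∈-interval⁻ {lo} w∈ with ∈-map⁻ (lo +_) w∈
... | i , i∈ , refl = m≤m+n lo i , +-monoʳ-< lo (∈-upTo⁻ i∈)

Unique-⊆-interval⇒length≤ : ∀ {xs lo len} → Unique xs → xs ⊆ interval lo len → length xs ≤ len
Unique-⊆-interval⇒length≤ {lo = lo} {len} u xs⊆ = subst (_ ≤_) (length-interval lo len) (Unique-⊆⇒length≤ u xs⊆)

Unique-bounded⇒length+lo≤hi : ∀ {xs lo hi} → Unique xs → (∀ {z} → z ∈ xs → lo ≤ z × z < hi) → lo ≤ hi →
                              length xs + lo ≤ hi
Unique-bounded⇒length+lo≤hi {lo = lo} {hi} u bounded lo≤hi =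
  subst (_ + lo ≤_) (m∸n+n≡m lo≤hi)
    (+-monoˡ-≤ lo (Unique-⊆-interval⇒length≤ u λ z∈ →
      let (lo≤z , z<hi) = bounded z∈ in ∈-interval⁺ lo≤z (subst (_ <_) (sym (m+[n∸m]≡n lo≤hi)) z<hi)))

interval-⊆-map⇒length≤ : ∀ {A : Set} {lo len} (f : A → ℕ) {vs} → interval lo len ⊆ map f vs → len ≤ length vs
interval-⊆-map⇒length≤ {lo = lo} {len} f {vs} interval⊆ =
  subst₂ _≤_ (length-interval lo len) (length-map f vs) (Unique-⊆⇒length≤ (interval-Unique lo len) interval⊆)

module _ {A C : Set} where

  length-concatMap : ∀ (F : C → List A) zs → length (concatMap F zs) ≡ sum (map (length ∘ F) zs)
  length-concatMap F []       = refl
  length-concatMap F (z ∷ zs) = trans (length-++ (F z)) (cong (length (F z) +_) (length-concatMap F zs))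

  concatMap-Unique : ∀ (F : C → List A) {zs} → Unique zs → (∀ z → Unique (F z)) →
                     (∀ {z z′ v} → v ∈ F z → v ∈ F z′ → z ≡ z′) → Unique (concatMap F zs)
  concatMap-Unique F u F-Unique owner =
    concat⁺ (All.map⁺ (universal F-Unique _))
            (AllPairs.map⁺ (AllPairs.map (λ z≢z′ {v} (v∈ , v∈′) → z≢z′ (owner v∈ v∈′)) u))

injective-bounded⇒count+lo≤hi : ∀ {m lo hi} (f : Fin m → ℕ) → (∀ {t t′} → f t ≡ f t′ → t ≡ t′) →
                                (∀ t → lo ≤ f t × f t < hi) → lo ≤ hi → m + lo ≤ hi
injective-bounded⇒count+lo≤hi {m} f f-injective bounded lo≤hi =
  subst (λ l → l + _ ≤ _) (length-map-allFin f)
    (Unique-bounded⇒length+lo≤hi (map⁺ f-injective (allFin⁺ m))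
      (λ z∈ → let (t , _ , z≡) = ∈-map⁻ f z∈ in subst (λ z → _ ≤ z × z < _) (sym z≡) (bounded t)) lo≤hi)

length-filter-allFin-bounded : ∀ {m lo hi} {P : Fin m → Set} (P? : ∀ i → Dec (P i)) →
                               (∀ i → P i → lo ≤ toℕ i × toℕ i < hi) → lo ≤ hi →
                               length (filter P? (allFin m)) + lo ≤ hi
length-filter-allFin-bounded {m} P? bounded lo≤hi =
  subst (λ l → l + _ ≤ _) (length-map toℕ (filter P? (allFin m)))
    (Unique-bounded⇒length+lo≤hi (map⁺ toℕ-injective (filter⁺ P? (allFin⁺ m)))
      (λ z∈ → let (i , i∈ , z≡) = ∈-map⁻ toℕ z∈ ; (_ , Pi) = ∈-filter⁻ P? {xs = allFin m} i∈
              in subst (λ z → _ ≤ z × z < _) (sym z≡) (bounded i Pi)) lo≤hi)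

-- Weights of item sets and increasing chains

module _ {A : Set} where

  sum-map-+ : ∀ (f g : A → ℕ) (zs : List A) → sum (map (λ z → f z + g z) zs) ≡ sum (map f zs) + sum (map g zs)
  sum-map-+ f g []       = refl
  sum-map-+ f g (z ∷ zs) = trans (cong (f z + g z +_) (sum-map-+ f g zs)) (interchange (f z) (g z) _ _)

  sum-map-mono-≤ : ∀ {f g : A → ℕ} → (∀ z → f z ≤ g z) → ∀ (zs : List A) → sum (map f zs) ≤ sum (map g zs)
  sum-map-mono-≤ f≤g []       = z≤n
  sum-map-mono-≤ f≤g (z ∷ zs) = +-mono-≤ (f≤g z) (sum-map-mono-≤ f≤g zs)

  sum-map-const : ∀ w (zs : List A) → sum (map (λ _ → w) zs) ≡ length zs * w
  sum-map-const w []       = refl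
  sum-map-const w (_ ∷ zs) = cong (w +_) (sum-map-const w zs)

  sum-filter : ∀ (f : A → ℕ) {P : A → Set} (P? : ∀ z → Dec (P z)) (zs : List A) →
               sum (map f (filter P? zs)) ≡ sum (map (λ z → if does (P? z) then f z else 0) zs)
  sum-filter f P? []       = refl
  sum-filter f P? (z ∷ zs) with P? z
  ... | yes _ = cong (f z +_) (sum-filter f P? zs)
  ... | no  _ = sum-filter f P? zs

-- The least t < m with C (suc t) ≡ true, and m if there is none.
firstStep : ℕ → (ℕ → Bool) → ℕ
firstStep zero    C = zero
firstStep (suc m) C = if C 1 then 0 else suc (firstStep m (C ∘ suc))

Increasing : (ℕ → Bool) → Set
Increasing C = ∀ t → C t ≡ true → C (suc t) ≡ true

does⇒ : ∀ {P : Set} (P? : Dec P) → does P? ≡ true → P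
does⇒ (yes p) _ = p

clash : ∀ {b} → b ≡ false → b ≡ true → ⊥
clash refl ()

firstStep-< : ∀ m {C : ℕ → Bool} → C 0 ≡ false → C m ≡ true → firstStep m C < m
firstStep-< zero    C0 Cm = ⊥-elim (clash C0 Cm)
firstStep-< (suc m) {C} C0 Cm with C 1 in C1
... | true  = s≤s z≤n
... | false = s≤s (firstStep-< m {C ∘ suc} C1 Cm)

firstStep-crossing : ∀ m {C : ℕ → Bool} → C 0 ≡ false → C m ≡ true →
                     C (firstStep m C) ≡ false × C (suc (firstStep m C)) ≡ true
firstStep-crossing zero    C0 Cm = ⊥-elim (clash C0 Cm)
firstStep-crossing (suc m) {C} C0 Cm with C 1 in C1
... | true  = C0 , C1
... | false = firstStep-crossing m {C ∘ suc} C1 Cm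

module _ {C : ℕ → Bool} (increasing : Increasing C) where

  increasing-≤ : ∀ {s t} → s ≤ t → C s ≡ true → C t ≡ true
  increasing-≤ {t = zero}  z≤n   Cs = Cs
  increasing-≤ {t = suc t} s≤1+t Cs with m≤n⇒m<n∨m≡n s≤1+t
  ... | inj₁ s<1+t = increasing t (increasing-≤ (≤-pred s<1+t) Cs)
  ... | inj₂ refl  = Cs

  crossing-unique : ∀ {l i} → C l ≡ false → C (suc l) ≡ true → C i ≡ false → C (suc i) ≡ true → l ≡ i
  crossing-unique {l} {i} Cl C1+l Ci C1+i with <-cmp l i
  ... | tri< l<i _ _ = ⊥-elim (clash Ci (increasing-≤ l<i C1+l))
  ... | tri≈ _ l≡i _ = l≡i
  ... | tri> _ _ i<l = ⊥-elim (clash Cl (increasing-≤ i<l C1+i))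

  crossing-indicator : ∀ {l} → C l ≡ false → C (suc l) ≡ true → ∀ i (l≟i : Dec (l ≡ i)) w →
                       (if does l≟i then w else 0) + (if C i then w else 0) ≡ (if C (suc i) then w else 0)
  crossing-indicator Cl C1+l i l≟i w with C i in Ci | C (suc i) in C1+i | l≟i
  ... | true  | true  | no  _    = refl
  ... | true  | true  | yes refl = ⊥-elim (clash Cl Ci)
  ... | true  | false | _        = ⊥-elim (clash C1+i (increasing i Ci))
  ... | false | true  | yes _    = +-identityʳ w
  ... | false | true  | no  l≢i  = ⊥-elim (l≢i (crossing-unique Cl C1+l Ci C1+i))
  ... | false | false | no  _    = refl
  ... | false | false | yes refl = ⊥-elim (clash C1+i C1+l)

module _ {n : ℕ} (a : Fin n → ℕ) where

  weight : (Fin n → Bool) → ℕ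
  weight C = sum (map (λ j → if C j then a j else 0) (allFin n))

  weight-disjoint-≤ : ∀ {C D : Fin n → Bool} → (∀ j → C j ≡ true → D j ≡ true → ⊥) →
                      weight C + weight D ≤ total n a
  weight-disjoint-≤ {C} {D} disjoint =
    subst (_≤ total n a) (sum-map-+ _ _ (allFin n)) (sum-map-mono-≤ pointwise (allFin n))
    where
    pointwise : ∀ j → (if C j then a j else 0) + (if D j then a j else 0) ≤ a j
    pointwise j with C j in Cj | D j in Dj
    ... | true  | true  = ⊥-elim (disjoint j Cj Dj)
    ... | true  | false = ≤-reflexive (+-identityʳ (a j))
    ... | false | true  = ≤-refl
    ... | false | false = z≤n

  module _ (k B : ℕ) (C : ℕ → Fin n → Bool)
           (C₀-empty : ∀ j → C 0 j ≡ false) (Cₖ-full : ∀ j → C k j ≡ true)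
           (increasing : ∀ j → Increasing (λ t → C t j))
           (weight-C : ∀ t → t ≤ k → weight (C t) ≡ t * B) where

    private
      firstStepOf : Fin n → ℕ
      firstStepOf j = firstStep k (λ t → C t j)

    layer : Fin n → Fin k
    layer j = fromℕ< (firstStep-< k {λ t → C t j} (C₀-empty j) (Cₖ-full j))

    binSum-layer : ∀ i → binSum n k a layer i ≡ B
    binSum-layer i = +-cancelʳ-≡ (toℕ i * B) _ _ (begin
      binSum n k a layer i + toℕ i * B
        ≡⟨ cong₂ _+_ (sum-filter a (λ j → layer j ≟ᶠ i) (allFin n)) (sym (weight-C (toℕ i) (<⇒≤ (toℕ<n i)))) ⟩
      sum (map (λ j → if does (layer≟ j) then a j else 0) (allFin n)) + weight (C (toℕ i))
        ≡⟨ sym (sum-map-+ _ _ (allFin n)) ⟩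
      sum (map (λ j → (if does (layer≟ j) then a j else 0) + (if C (toℕ i) j then a j else 0)) (allFin n))
        ≡⟨ cong sum (map-cong crossing-step (allFin n)) ⟩
      weight (C (suc (toℕ i)))
        ≡⟨ weight-C (suc (toℕ i)) (toℕ<n i) ⟩
      suc (toℕ i) * B ∎)
      where
      open ≡-Reasoning
      layer≟ : ∀ j → Dec (firstStepOf j ≡ toℕ i)
      layer≟ j = map′ (λ e → trans (sym (toℕ-fromℕ< _)) (cong toℕ e))
                      (λ e → toℕ-injective (trans (toℕ-fromℕ< _) e)) (layer j ≟ᶠ i)
      crossing-step : ∀ j → (if does (layer≟ j) then a j else 0) + (if C (toℕ i) j then a j else 0)
                            ≡ (if C (suc (toℕ i)) j then a j else 0)
      crossing-step j = let (Cl , C1+l) = firstStep-crossing k {λ t → C t j} (C₀-empty j) (Cₖ-full j)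
                        in crossing-indicator (increasing j) Cl C1+l (toℕ i) (layer≟ j) (a j)

  -- Only the inner sets C 1 ⊆ … ⊆ C (k - 1) matter: they are capped by ∅ below and by all items above.
  chain⇒BinPackingYes : ∀ k′ B (C : ℕ → Fin n → Bool) → total n a ≡ suc k′ * B →
                        (∀ j → Increasing (λ t → C t j)) →
                        (∀ t → 1 ≤ t → t < suc k′ → weight (C t) ≡ t * B) →
                        BinPackingYes n a (suc k′)
  chain⇒BinPackingYes k′ B C total≡ increasing weight-C =
    layer k B capped (λ _ → refl) capped-full capped-increasing weight-capped ,
    λ i → trans (cong (k *_) (binSum-layer k B capped (λ _ → refl) capped-full capped-increasing weight-capped i))
                (sym total≡)
    where
    k = suc k′

    capped : ℕ → Fin n → Bool
    capped zero    j = false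
    capped (suc t) j with suc t <? k
    ... | yes _ = C (suc t) j
    ... | no  _ = true

    capped-full : ∀ j → capped k j ≡ true
    capped-full j with k <? k
    ... | yes k<k = ⊥-elim (<-irrefl refl k<k)
    ... | no  _   = refl

    capped-increasing : ∀ j → Increasing (λ t → capped t j)
    capped-increasing j (suc t) Ct with suc t <? k | suc (suc t) <? k
    ... | _        | no  _   = refl
    ... | yes _    | yes _   = increasing j (suc t) Ct
    ... | no  t≮k  | yes t<k = ⊥-elim (t≮k (<-trans (n<1+n (suc t)) t<k))

    weight-capped : ∀ t → t ≤ k → weight (capped t) ≡ t * B
    weight-capped zero    _   = trans (sum-map-const 0 (allFin n)) (*-zeroʳ (length (allFin n)))
    weight-capped (suc t) t≤k with suc t <? k
    ... | yes t<k = weight-C (suc t) (s≤s z≤n) t<k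
    ... | no  t≮k = trans total≡ (cong (_* B) (≤-antisym (≮⇒≥ t≮k) t≤k))

-- Orderings of bounded stretch

record Layout {V : Set} (E : V → V → Set) (b : ℕ) : Set where
  field
    N                : ℕ
    place            : V → ℕ
    place-injective  : ∀ {u v} → place u ≡ place v → u ≡ v
    place<N          : ∀ v → place v < N
    place-surjective : ∀ {w} → w < N → ∃ λ v → place v ≡ w
    edge-≤           : ∀ {u v} → E u v → place v ≤ place u + b
    edge-≥           : ∀ {u v} → E u v → place u ≤ place v + b

module _ {N : ℕ} where

  reflect-< : ∀ {w} → w < N → N ∸ suc w < N
  reflect-< {w} (s≤s _) = s≤s (m∸n≤m _ w)

  reflect-involutive : ∀ {w} → w < N → N ∸ suc (N ∸ suc w) ≡ w
  reflect-involutive (s≤s w<N) = m∸[m∸n]≡n w<N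

  reflect-injective : ∀ {u w} → u < N → w < N → N ∸ suc u ≡ N ∸ suc w → u ≡ w
  reflect-injective u<N w<N eq = suc-injective (∸-cancelˡ-≡ u<N w<N eq)

  reflect-≤ : ∀ {u w b} → u < N → u ≤ w + b → N ∸ suc w ≤ N ∸ suc u + b
  reflect-≤ {u} {w} {b} (s≤s {n = N′} u≤N′) u≤w+b = m≤n+o⇒m∸n≤o N′ w (begin
    N′                 ≡⟨ m+[n∸m]≡n u≤N′ ⟨
    u + (N′ ∸ u)       ≤⟨ +-monoˡ-≤ (N′ ∸ u) u≤w+b ⟩
    w + b + (N′ ∸ u)   ≡⟨ +-assoc w b (N′ ∸ u) ⟩
    w + (b + (N′ ∸ u)) ≡⟨ cong (w +_) (+-comm b (N′ ∸ u)) ⟩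
    w + (N′ ∸ u + b)   ∎)
    where open ≤-Reasoning

module _ {V : Set} {E : V → V → Set} {b : ℕ} where

  BandwidthYes⇒Layout : BandwidthYes V E b → Layout E b
  BandwidthYes⇒Layout (N , π , stretch) = record
    { N                = N
    ; place            = place
    ; place-injective  = λ eq → Bijection.injective π (toℕ-injective eq)
    ; place<N          = λ v → toℕ<n (to v)
    ; place-surjective = surjective
    ; edge-≤           = λ {u} {v} e → ≤-trans (m≤n+∣n-m∣ (place v) (place u)) (+-monoʳ-≤ (place u) (stretch u v e))
    ; edge-≥           = λ {u} {v} e → ≤-trans (m≤n+∣m-n∣ (place u) (place v)) (+-monoʳ-≤ (place v) (stretch u v e))
    }
    where
    open Bijection π using (to)
    place : V → ℕ
    place v = toℕ (to v)
    surjective : ∀ {w} → w < N → ∃ λ v → place v ≡ w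
    surjective w<N with Bijection.surjective π (fromℕ< w<N)
    ... | v , to≡ = v , trans (cong toℕ (to≡ refl)) (toℕ-fromℕ< w<N)

  reverse : Layout E b → Layout E b
  reverse L = record
    { N                = N
    ; place            = place′
    ; place-injective  = λ eq → place-injective (reflect-injective (place<N _) (place<N _) eq)
    ; place<N          = λ v → reflect-< (place<N v)
    ; place-surjective = surjective′
    ; edge-≤           = λ e → reflect-≤ (place<N _) (edge-≥ e)
    ; edge-≥           = λ e → reflect-≤ (place<N _) (edge-≤ e)
    }
    where
    open Layout L
    mirror : ℕ → ℕ
    mirror w = N ∸ suc w
    place′ : V → ℕ
    place′ v = mirror (place v)
    surjective′ : ∀ {w} → w < N → ∃ λ v → place′ v ≡ w
    surjective′ w<N with place-surjective (reflect-< w<N)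
    ... | v , place≡ = v , trans (cong mirror place≡) (reflect-involutive w<N)

  reverse-< : (L : Layout E b) → ∀ {u v} → Layout.place L u < Layout.place L v →
              Layout.place (reverse L) v < Layout.place (reverse L) u
  reverse-< L {u} {v} u<v = ∸-monoʳ-< (s≤s u<v) (Layout.place<N L v)

module _ {V : Set} {E : V → V → Set} {b : ℕ} (L : Layout E b) where

  open Layout L

  interval-occupied : ∀ {lo len} {ps : List ℕ} → lo + len ≤ N →
                      (∀ v → lo ≤ place v → place v < lo + len → place v ∈ ps) → interval lo len ⊆ ps
  interval-occupied lo+len≤N occupant w∈ with ∈-interval⁻ w∈
  ... | lo≤w , w< with place-surjective (<-≤-trans w< lo+len≤N)
  ... | v , refl = occupant v lo≤w w<

module CliqueWindow {V : Set} {E : V → V → Set} {b : ℕ} (L : Layout E b)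
                    {S : ℕ} (S≡1+b : S ≡ suc b) (g : Fin S → V)
                    (g-injective : ∀ {m m′} → g m ≡ g m′ → m ≡ m′)
                    (g-clique : ∀ m m′ → m ≢ m′ → E (g m) (g m′)) where

  open Layout L

  -- Abstract, so that argmin over allFin S is never unfolded during conversion checking.
  abstract
    lowest : Fin S
    lowest = argmin (place ∘ g) (subst Fin (sym S≡1+b) zero) (allFin S)

    lowest-minimal : ∀ m → place (g lowest) ≤ place (g m)
    lowest-minimal m = lookup (f[argmin]≤f[xs] _ (allFin S)) (∈-allFin m)

  start : ℕ
  start = place (g lowest)

  start≤ : ∀ m → start ≤ place (g m)
  start≤ = lowest-minimal

  ≤start+b : ∀ m → place (g m) ≤ start + b
  ≤start+b m with lowest ≟ᶠ m
  ... | yes refl = m≤m+n start b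
  ... | no  l≢m  = edge-≤ (g-clique lowest m l≢m)

  private
    places : List ℕ
    places = map (place ∘ g) (allFin S)

    <start+S : ∀ {w} → w ≤ start + b → w < start + S
    <start+S {w} w≤ = subst (w <_) (sym (trans (cong (start +_) S≡1+b) (+-suc start b))) (s≤s w≤)

    places⊆window : places ⊆ interval start S
    places⊆window z∈ with ∈-map⁻ (place ∘ g) z∈
    ... | m , _ , refl = ∈-interval⁺ (start≤ m) (<start+S (≤start+b m))

    window⊆places : interval start S ⊆ places
    window⊆places = Unique-⊆-length≥⇒⊇ _≟_ (map⁺ (g-injective ∘ place-injective) (allFin⁺ S)) places⊆window
      (≤-reflexive (trans (length-interval start S) (sym (length-map-allFin (place ∘ g)))))

  fill : ∀ {w} → start ≤ w → w ≤ start + b → ∃ λ m → place (g m) ≡ w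
  fill start≤w w≤start+b with ∈-map⁻ (place ∘ g) (window⊆places (∈-interval⁺ start≤w (<start+S w≤start+b)))
  ... | m , _ , w≡ = m , sym w≡

-- The blocks X^i and Y^i

m<n⇒m≤n∸1 : ∀ {m n} → m < n → m ≤ n ∸ 1
m<n⇒m≤n∸1 {n = suc n} (s≤s m≤n) = m≤n

module _ (k B : ℕ) where

  2[1+j]B∸B : ∀ j → 2 * suc j * B ∸ B ≡ 2 * j * B + B
  2[1+j]B∸B j = trans (cong (_∸ B) (distrib j B)) (m+n∸n≡m (2 * j * B + B) B)
    where distrib : ∀ j B → 2 * suc j * B ≡ 2 * j * B + B + B
          distrib = solve-∀

  InXFrom-tail′ : ∀ f {i j m} → f + j ≡ k → i ≤ j →
                  2 * j * B ∸ B + 2 ≤ m → m ≤ 2 * k * B + B → InXFrom k B i m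
  InXFrom-tail′ zero              refl i≤j lo hi = _ , i≤j , ≤-refl , inj₂ (refl , lo , hi)
  InXFrom-tail′ (suc f) {j = j} {m} f+j≡k i≤j lo hi with m ≤? 2 * j * B + B + 1
  ... | yes m≤ = j , i≤j , <⇒≤ j<k , inj₁ (j<k , lo , m≤)
    where j<k : j < k
          j<k = subst (suc j ≤_) f+j≡k (s≤s (m≤n+m j f))
  ... | no  m≰ = InXFrom-tail′ f (trans (+-suc f j) f+j≡k) (m≤n⇒m≤1+n i≤j)
                   (subst (_≤ m) next-start (≰⇒> m≰)) hi
    where next-start : suc (2 * j * B + B + 1) ≡ 2 * suc j * B ∸ B + 2
          next-start = trans (sym (+-suc _ 1)) (cong (_+ 2) (sym (2[1+j]B∸B j)))

  InXFrom-tail : ∀ {i m} → i ≤ k → 2 * i * B ∸ B + 2 ≤ m → m ≤ 2 * k * B + B → InXFrom k B i m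
  InXFrom-tail {i} i≤k = InXFrom-tail′ (k ∸ i) (m∸n+n≡m i≤k) ≤-refl

  InYUpTo-head′ : ∀ j {i m} → suc j ≤ i → 1 ≤ m → m ≤ 2 * suc j * B + B ∸ 1 → InYUpTo k B i m
  InYUpTo-head′ zero {m = m} j≤i 1≤m hi =
    1 , ≤-refl , j≤i , inj₁ (refl , 1≤m , subst (λ z → m ≤ z ∸ 1) (three B) hi)
    where three : ∀ B → 2 * 1 * B + B ≡ 3 * B
          three = solve-∀
  InYUpTo-head′ (suc j) {i} {m} j≤i 1≤m hi with 2 * suc (suc j) * B ∸ B ≤? m
  ... | yes lo = suc (suc j) , s≤s z≤n , j≤i , inj₂ (s≤s (s≤s z≤n) , lo , hi)
  ... | no  lo = InYUpTo-head′ j (<⇒≤ j≤i) 1≤m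
                   (m<n⇒m≤n∸1 (subst (m <_) (2[1+j]B∸B (suc j)) (≰⇒> lo)))

  InYUpTo-head : ∀ {i m} → 1 ≤ i → 1 ≤ m → m ≤ 2 * i * B + B ∸ 1 → InYUpTo k B i m
  InYUpTo-head {suc i} _ = InYUpTo-head′ i ≤-refl

-- The constructed graph

module Construction (n : ℕ) (a : Fin n → ℕ) (k′ c : ℕ) where

  k B b S : ℕ
  k = suc k′
  B = suc c
  b = 2 * k * B + c
  S = size k B

  V : Set
  V = Vtx n a k B

  E : V → V → Set
  E = Edge n a k B

  S≡1+b : S ≡ suc b
  S≡1+b = +-suc (2 * k * B) c

  bound≡b : bound k B ≡ b
  bound≡b = cong (_∸ 1) S≡1+b

  x-injective : ∀ {m m′} → x {n} {a} {k} {B} m ≡ x m′ → m ≡ m′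
  x-injective refl = refl

  y-injective : ∀ {m m′} → y {n} {a} {k} {B} m ≡ y m′ → m ≡ m′
  y-injective refl = refl

  b<S : b < S
  b<S = subst (b <_) (sym S≡1+b) (n<1+n b)

  lastX : Fin S
  lastX = fromℕ< b<S

  pos-lastX : pos lastX ≡ 2 * k * B + B
  pos-lastX = trans (cong suc (toℕ-fromℕ< b<S)) (sym S≡1+b)

  lastB : Fin B
  lastB = fromℕ c

  pos-lastB : pos lastB ≡ B
  pos-lastB = cong suc (toℕ-fromℕ c)

  lastX-InXFrom : ∀ {i} → i ≤ k → InXFrom k B i (2 * k * B + B)
  lastX-InXFrom i≤k = k , i≤k , ≤-refl , inj₂ (refl , first-of-Xᵏ≤ k′ c , ≤-refl)
    where first-of-Xᵏ≤ : ∀ k′ c → 2 * suc k′ * suc c ∸ suc c + 2 ≤ 2 * suc k′ * suc c + suc c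
          first-of-Xᵏ≤ k′ c = subst (λ z → z + 2 ≤ 2 * suc k′ * suc c + suc c) (sym (2[1+j]B∸B k (suc c) k′))
                                (subst (2 * k′ * suc c + suc c + 2 ≤_) (rearrange k′ c) (m≤m+n _ (2 * c)))
            where rearrange : ∀ k′ c → 2 * k′ * suc c + suc c + 2 + 2 * c ≡ 2 * suc k′ * suc c + suc c
                  rearrange = solve-∀

  firstY-InYUpTo : ∀ {i} → 1 ≤ i → InYUpTo k B i 1
  firstY-InYUpTo 1≤i = 1 , ≤-refl , 1≤i , inj₁ (refl , ≤-refl , subst (1 ≤_) (sym (+-suc c _)) (s≤s z≤n))

  slice : ∀ lo {cnt} → lo + cnt ≤ S → Fin cnt → Fin S
  slice lo lo+cnt≤S t = fromℕ< (<-≤-trans (+-monoʳ-< lo (toℕ<n t)) lo+cnt≤S)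

  toℕ-slice : ∀ lo {cnt} (lo+cnt≤S : lo + cnt ≤ S) t → toℕ (slice lo lo+cnt≤S t) ≡ lo + toℕ t
  toℕ-slice lo lo+cnt≤S t = toℕ-fromℕ< _

  slice-injective : ∀ lo {cnt} (lo+cnt≤S : lo + cnt ≤ S) {t t′} →
                    slice lo lo+cnt≤S t ≡ slice lo lo+cnt≤S t′ → t ≡ t′
  slice-injective lo lo+cnt≤S {t} {t′} eq = toℕ-injective (+-cancelˡ-≡ lo _ _
    (trans (sym (toℕ-slice lo lo+cnt≤S t)) (trans (cong toℕ eq) (toℕ-slice lo lo+cnt≤S t′))))

  itemSideIf : (Fin n → Bool) → Side → Fin n → List V
  itemSideIf C s j = if C j then map (it s j) (allFin (a j)) else []

  selected : (Fin n → Bool) → Side → List V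
  selected C s = concatMap (itemSideIf C s) (allFin n)

  length-selected : ∀ C s → length (selected C s) ≡ weight a C
  length-selected C s =
    trans (length-concatMap (itemSideIf C s) (allFin n)) (cong sum (map-cong length-if (allFin n)))
    where length-if : ∀ j → length (itemSideIf C s j) ≡ (if C j then a j else 0)
          length-if j with C j
          ... | true  = length-map-allFin (it {a = a} {k} {B} s j)
          ... | false = refl

  ∈-selected⁺ : ∀ {C s j} r → C j ≡ true → it s j r ∈ selected C s
  ∈-selected⁺ {C} {s} {j} r Cj = ∈-concatMap⁺ (itemSideIf C s) (lose (∈-allFin j) (member Cj))
    where member : ∀ {b} → b ≡ true → it s j r ∈ (if b then map (it s j) (allFin (a j)) else [])
          member refl = ∈-map⁺ (it s j) (∈-allFin r)

  delimiterSide : Side → Fin k → List V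
  delimiterSide s i = map (d s i) (allFin B)

  delimiters : {P : Fin k → Set} → (∀ i → Dec (P i)) → Side → List V
  delimiters P? s = concatMap (delimiterSide s) (filter P? (allFin k))

  length-delimiters : ∀ {P : Fin k → Set} (P? : ∀ i → Dec (P i)) s →
                      length (delimiters P? s) ≡ length (filter P? (allFin k)) * B
  length-delimiters P? s = trans (length-concatMap (delimiterSide s) (filter P? (allFin k)))
    (trans (cong sum (map-cong (λ i → length-map-allFin (d s i)) (filter P? (allFin k))))
           (sum-map-const B (filter P? (allFin k))))

  ∈-delimiters⁺ : ∀ {P : Fin k → Set} (P? : ∀ i → Dec (P i)) {s i} u → P i → d s i u ∈ delimiters P? s
  ∈-delimiters⁺ P? {s} {i} u Pi =
    ∈-concatMap⁺ (delimiterSide s) (lose (∈-filter⁺ P? (∈-allFin i) Pi) (∈-map⁺ (d s i) (∈-allFin u)))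

  module _ {m : ℕ} (f : Side → Fin m → V) where

    bothSides : List V
    bothSides = map (f left) (allFin m) ++ map (f right) (allFin m)

    length-bothSides : length bothSides ≡ m + m
    length-bothSides = trans (length-++ (map (f left) (allFin m)))
                             (cong₂ _+_ (length-map-allFin (f left)) (length-map-allFin (f right)))

    ∈-bothSides⁻ : ∀ {v} → v ∈ bothSides → ∃ λ s → ∃ λ u → v ≡ f s u
    ∈-bothSides⁻ v∈ with ∈-++⁻ (map (f left) (allFin m)) v∈
    ... | inj₁ v∈ᴸ = let (u , _ , v≡) = ∈-map⁻ (f left) v∈ᴸ in left , u , v≡
    ... | inj₂ v∈ᴿ = let (u , _ , v≡) = ∈-map⁻ (f right) v∈ᴿ in right , u , v≡

    bothSides-Unique : (∀ {s s′ u u′} → f s u ≡ f s′ u′ → s ≡ s′ × u ≡ u′) → Unique bothSides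
    bothSides-Unique f-injective =
      ++⁺ (map⁺ (proj₂ ∘ f-injective) (allFin⁺ m)) (map⁺ (proj₂ ∘ f-injective) (allFin⁺ m)) λ (v∈ᴸ , v∈ᴿ) →
        let (_ , _ , v≡ᴸ) = ∈-map⁻ (f left) v∈ᴸ ; (_ , _ , v≡ᴿ) = ∈-map⁻ (f right) v∈ᴿ
        in left≢right (proj₁ (f-injective (trans (sym v≡ᴸ) v≡ᴿ)))
      where left≢right : left ≢ right
            left≢right ()

  delimiterClique : Fin k → List V
  delimiterClique i = bothSides (λ s → d s i)

  itemClique : Fin n → List V
  itemClique j = bothSides (λ s → it s j)

  delimiterVertices itemVertices middleVertices : List V
  delimiterVertices = concatMap delimiterClique (allFin k)
  itemVertices      = concatMap itemClique (allFin n)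
  middleVertices    = delimiterVertices ++ itemVertices

  middleVertices-Unique : Unique middleVertices
  middleVertices-Unique =
    ++⁺ (concatMap-Unique delimiterClique (allFin⁺ k) delimiterClique-Unique delimiter-owner)
        (concatMap-Unique itemClique (allFin⁺ n) itemClique-Unique item-owner)
        λ (v∈ᴰ , v∈ᴵ) → delimiter≢item v∈ᴰ v∈ᴵ
    where
    delimiterClique-Unique : ∀ i → Unique (delimiterClique i)
    delimiterClique-Unique i = bothSides-Unique (λ s → d s i) λ { refl → refl , refl }
    itemClique-Unique : ∀ j → Unique (itemClique j)
    itemClique-Unique j = bothSides-Unique (λ s → it s j) λ { refl → refl , refl }
    delimiter-owner : ∀ {i i′ v} → v ∈ delimiterClique i → v ∈ delimiterClique i′ → i ≡ i′
    delimiter-owner {i} {i′} v∈ v∈′ with ∈-bothSides⁻ (λ s → d s i) v∈ | ∈-bothSides⁻ (λ s → d s i′) v∈′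
    ... | _ , _ , refl | _ , _ , refl = refl
    item-owner : ∀ {j j′ v} → v ∈ itemClique j → v ∈ itemClique j′ → j ≡ j′
    item-owner {j} {j′} v∈ v∈′ with ∈-bothSides⁻ (λ s → it s j) v∈ | ∈-bothSides⁻ (λ s → it s j′) v∈′
    ... | _ , _ , refl | _ , _ , refl = refl
    delimiter≢item : ∀ {v} → v ∈ delimiterVertices → v ∈ itemVertices → ⊥
    delimiter≢item v∈ᴰ v∈ᴵ with find (∈-concatMap⁻ delimiterClique {allFin k} v∈ᴰ)
                                 | find (∈-concatMap⁻ itemClique {allFin n} v∈ᴵ)
    ... | i , _ , v∈ᵢ | j , _ , v∈ⱼ with ∈-bothSides⁻ (λ s → d s i) v∈ᵢ | ∈-bothSides⁻ (λ s → it s j) v∈ⱼ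
    ... | _ , _ , refl | _ , _ , ()

  length-middleVertices : length middleVertices ≡ k * (B + B) + (total n a + total n a)
  length-middleVertices = begin
    length middleVertices
      ≡⟨ length-++ delimiterVertices {itemVertices} ⟩
    length delimiterVertices + length itemVertices
      ≡⟨ cong₂ _+_ (length-concatMap delimiterClique (allFin k)) (length-concatMap itemClique (allFin n)) ⟩
    sum (map (length ∘ delimiterClique) (allFin k)) + sum (map (length ∘ itemClique) (allFin n))
      ≡⟨ cong₂ _+_ (cong sum (map-cong (λ i → length-bothSides (λ s → d s i)) (allFin k)))
                   (cong sum (map-cong (λ j → length-bothSides (λ s → it s j)) (allFin n))) ⟩
    sum (map (λ _ → B + B) (allFin k)) + sum (map (λ j → a j + a j) (allFin n))
      ≡⟨ cong₂ _+_ (trans (sum-map-const (B + B) (allFin k)) (cong (_* (B + B)) (length-allFin k)))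
                   (sum-map-+ a a (allFin n)) ⟩
    k * (B + B) + (total n a + total n a) ∎
    where open ≡-Reasoning

  module Oriented (total≡ : total n a ≡ k * B) (L : Layout E b)
                  (x₁<y₁ : Layout.place L (x zero) < Layout.place L (y zero)) where

    open Layout L

    module X = CliqueWindow L S≡1+b x x-injective xx
    module Y = CliqueWindow L S≡1+b y y-injective yy

    e q : ℕ
    e = X.start + b
    q = Y.start

    -- Otherwise the position X.start ⊔ q would lie in both windows.
    X-before-Y : e < q
    X-before-Y with q ≤? e
    ... | no  q≰e = ≰⇒> q≰e
    ... | yes q≤e with X.fill (m≤m⊔n X.start q) (⊔-lub (m≤m+n X.start b) q≤e)
                     | Y.fill (m≤n⊔m X.start q) (⊔-lub start≤q+b (m≤m+n q b))
      where start≤q+b : X.start ≤ q + b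
            start≤q+b = <⇒≤ (≤-<-trans (X.start≤ zero) (<-≤-trans x₁<y₁ (Y.≤start+b zero)))
    ...   | m , xₘ≡ | m′ , yₘ′≡ with place-injective (trans xₘ≡ (sym yₘ′≡))
    ...     | ()

    after-X : ∀ {v} → (∀ {m} → v ≢ x m) → X.start ≤ place v → e < place v
    after-X {v} v≢x start≤v with place v ≤? e
    ... | no  v≰e = ≰⇒> v≰e
    ... | yes v≤e with X.fill start≤v v≤e
    ...   | m , xₘ≡ = ⊥-elim (v≢x (place-injective (sym xₘ≡)))

    before-Y : ∀ {v} → (∀ {m} → v ≢ y m) → place v ≤ q + b → place v < q
    before-Y {v} v≢y v≤q+b with q ≤? place v
    ... | no  q≰v = ≰⇒> q≰v
    ... | yes q≤v with Y.fill q≤v v≤q+b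
    ...   | m , yₘ≡ = ⊥-elim (v≢y (place-injective (sym yₘ≡)))

    reaches-Y⇒after-start : ∀ {w} → q ≤ w + b → X.start < w
    reaches-Y⇒after-start q≤w+b = +-cancelʳ-< b _ _ (<-≤-trans X-before-Y q≤w+b)

    lastX≤e : place (x lastX) ≤ e
    lastX≤e = X.≤start+b lastX

    q≤firstY : q ≤ place (y zero)
    q≤firstY = Y.start≤ zero

    Between : V → Set
    Between v = e < place v × place v < q

    itemˡ≤e+b : ∀ j r → place (it left j r) ≤ e + b
    itemˡ≤e+b j r = ≤-trans (edge-≤ (xA j r lastX pos-lastX)) (+-monoˡ-≤ b lastX≤e)

    q≤itemʳ+b : ∀ j r → q ≤ place (it right j r) + b
    q≤itemʳ+b j r = ≤-trans q≤firstY (edge-≥ (yA j r zero refl))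

    item-between : ∀ s j r → Between (it s j r)
    item-between s j r = side-between s
      where
      aᴸ aᴿ : V
      aᴸ = it left j r
      aᴿ = it right j r
      aᴿ≤aᴸ+b : place aᴿ ≤ place aᴸ + b
      aᴿ≤aᴸ+b = edge-≤ (aa j left right r r λ ())
      e<aᴿ : e < place aᴿ
      e<aᴿ = after-X (λ ()) (<⇒≤ (reaches-Y⇒after-start (q≤itemʳ+b j r)))
      e<aᴸ : e < place aᴸ
      e<aᴸ with X.start ≤? place aᴸ
      ... | yes start≤aᴸ = after-X (λ ()) start≤aᴸ
      ... | no  start≰aᴸ = ⊥-elim (<⇒≱ e<aᴿ (≤-trans aᴿ≤aᴸ+b (<⇒≤ (+-monoˡ-< b (≰⇒> start≰aᴸ)))))
      aᴸ<q : place aᴸ < q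
      aᴸ<q = before-Y (λ ()) (≤-trans (itemˡ≤e+b j r) (+-monoˡ-≤ b (<⇒≤ X-before-Y)))
      aᴿ<q : place aᴿ < q
      aᴿ<q with place aᴿ ≤? q + b
      ... | yes aᴿ≤q+b = before-Y (λ ()) aᴿ≤q+b
      ... | no  aᴿ≰q+b = ⊥-elim (<-asym aᴸ<q (+-cancelʳ-< b _ _ (<-≤-trans (≰⇒> aᴿ≰q+b) aᴿ≤aᴸ+b)))
      side-between : ∀ s → Between (it s j r)
      side-between left  = e<aᴸ , aᴸ<q
      side-between right = e<aᴿ , aᴿ<q

    module Delimiter (i : Fin k) where

      ℓ r : V
      ℓ = d left i zero
      r = d right i lastB

      ℓ≤e+b : place ℓ ≤ e + b
      ℓ≤e+b = ≤-trans (edge-≥ (l1x i zero lastX refl lastX∈Xⁱ⁺)) (+-monoˡ-≤ b lastX≤e)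
        where lastX∈Xⁱ⁺ = subst (InXFrom k B (pos i)) (sym pos-lastX) (lastX-InXFrom (toℕ<n i))

      q≤r+b : q ≤ place r + b
      q≤r+b = ≤-trans q≤firstY (edge-≤ (rBy i lastB zero pos-lastB (firstY-InYUpTo (s≤s z≤n))))

      near-ℓ : ∀ s u → place (d s i u) ≤ place ℓ + b
      near-ℓ left  zero    = m≤m+n (place ℓ) b
      near-ℓ left  (suc u) = edge-≤ (dd i left left zero (suc u) λ ())
      near-ℓ right u       = edge-≤ (dd i left right zero u λ ())

      near-r : ∀ s u → place r ≤ place (d s i u) + b
      near-r left  u = edge-≤ (dd i left right u lastB λ ())
      near-r right u with u ≟ᶠ lastB
      ... | yes refl = m≤m+n (place r) b
      ... | no  u≢   = edge-≤ (dd i right right u lastB λ { refl → u≢ refl })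

      e<r : e < place r
      e<r = after-X (λ ()) (<⇒≤ (reaches-Y⇒after-start q≤r+b))

      ℓ<q : place ℓ < q
      ℓ<q = before-Y (λ ()) (≤-trans ℓ≤e+b (+-monoˡ-≤ b (<⇒≤ X-before-Y)))

      delimiter-between : ∀ s u → Between (d s i u)
      delimiter-between s u =
        after-X (λ ()) (<⇒≤ (+-cancelʳ-< b _ _ (<-≤-trans e<r (near-r s u)))) ,
        before-Y (λ ()) (≤-trans (near-ℓ s u) (<⇒≤ (+-monoˡ-< b ℓ<q)))

    delimiterˡ≤e+b : ∀ i u → place (d left i u) ≤ e + b
    delimiterˡ≤e+b i u with pos i <? k
    ... | yes i<k = ≤-trans (edge-≤ (xL i u m i<k pos-m)) (+-monoˡ-≤ b (X.≤start+b m))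
      where
      m<S : 2 * pos i * B + B < S
      m<S = +-monoˡ-< B (*-monoˡ-< B (*-monoʳ-< 2 i<k))
      m = fromℕ< m<S
      pos-m : pos m ≡ 2 * pos i * B + B + 1
      pos-m = trans (cong suc (toℕ-fromℕ< m<S)) (+-comm 1 _)
    ... | no  i≮k = ≤-trans (edge-≤ (xLk i u lastX (≤-antisym (toℕ<n i) (≮⇒≥ i≮k)) pos-lastX))
                            (+-monoˡ-≤ b lastX≤e)

    q≤delimiterʳ+b : ∀ i u → q ≤ place (d right i u) + b
    q≤delimiterʳ+b zero     u = ≤-trans q≤firstY (edge-≥ (yR1 zero u zero refl refl))
    q≤delimiterʳ+b (suc i′) u = ≤-trans (Y.start≤ m) (edge-≥ (yR (suc i′) u m (s≤s (s≤s z≤n)) pos-m))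
      where
      m<S : 2 * toℕ (suc i′) * B + c < S
      m<S = subst (_≤ S) (+-suc _ c) (+-monoˡ-≤ B (*-monoˡ-≤ B (*-monoʳ-≤ 2 (<⇒≤ (toℕ<n (suc i′))))))
      m = fromℕ< m<S
      pos-m : pos m ≡ 2 * pos (suc i′) * B ∸ B
      pos-m = trans (cong suc (toℕ-fromℕ< m<S)) (trans (sym (+-suc _ c)) (sym (2[1+j]B∸B k B (toℕ (suc i′)))))

    middle-between : ∀ {v} → v ∈ middleVertices → Between v
    middle-between v∈ with ∈-++⁻ delimiterVertices v∈
    ... | inj₁ v∈ᴰ with find (∈-concatMap⁻ delimiterClique {allFin k} v∈ᴰ)
    ...   | i , _ , v∈ᵢ with ∈-bothSides⁻ (λ s → d s i) v∈ᵢ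
    ...     | s , u , refl = Delimiter.delimiter-between i s u
    middle-between v∈ | inj₂ v∈ᴵ with find (∈-concatMap⁻ itemClique {allFin n} v∈ᴵ)
    ...   | j , _ , v∈ⱼ with ∈-bothSides⁻ (λ s → it s j) v∈ⱼ
    ...     | s , u , refl = item-between s j u

    gap : e + 4 * k * B < q
    gap = begin
      suc (e + 4 * k * B)      ≡⟨ cong (λ l → suc (e + l)) length-places ⟨
      suc (e + length places)  ≡⟨ +-comm (suc e) (length places) ⟩
      length places + suc e    ≤⟨ Unique-bounded⇒length+lo≤hi (map⁺ place-injective middleVertices-Unique)
                                                              places-between X-before-Y ⟩
      q                        ∎
      where
      open ≤-Reasoning
      places : List ℕ
      places = map place middleVertices
      length-places : length places ≡ 4 * k * B
      length-places = trans (length-map place middleVertices)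
                        (trans length-middleVertices (trans (cong (λ t → k * (B + B) + (t + t)) total≡) (four k B)))
        where four : ∀ k B → k * (B + B) + (k * B + k * B) ≡ 4 * k * B
              four = solve-∀
      places-between : ∀ {z} → z ∈ places → e < z × z < q
      places-between z∈ with ∈-map⁻ place z∈
      ... | v , v∈ , refl = middle-between v∈

    module DelimiterWindow (i : Fin k) where

      open Delimiter i

      i₀ rest : ℕ
      i₀ = toℕ i
      rest = proj₁ (m≤n⇒∃[o]m+o≡n (toℕ<n i))

      1+i₀+rest≡k : suc i₀ + rest ≡ k
      1+i₀+rest≡k = proj₂ (m≤n⇒∃[o]m+o≡n (toℕ<n i))

      -- ℓ^i_1 is adjacent to the 2·rest·B + B + c vertices of X^i ∪ … ∪ X^k, all placed at or before e.
      tailX-count : 2 * rest * B + B + c + place ℓ ≤ suc (e + b)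
      tailX-count = injective-bounded⇒count+lo≤hi (λ t → place (x (tailX t)) + b)
        (λ eq → slice-injective _ tail-fits (x-injective (place-injective (+-cancelʳ-≡ b _ _ eq))))
        (λ t → edge-≥ (l1x i zero (tailX t) refl (tailX∈Xⁱ⁺ t)) , s≤s (+-monoˡ-≤ b (X.≤start+b (tailX t))))
        (≤-trans ℓ≤e+b (n≤1+n _))
        where
        tail-fits : 2 * i₀ * B + B + 1 + (2 * rest * B + B + c) ≤ S
        tail-fits = ≤-reflexive (subst (λ K → 2 * i₀ * B + B + 1 + (2 * rest * B + B + c) ≡ 2 * K * B + B) 1+i₀+rest≡k
                                  (sizes i₀ rest c))
          where sizes : ∀ i₀ rest c → 2 * i₀ * suc c + suc c + 1 + (2 * rest * suc c + suc c + c)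
                                       ≡ 2 * (suc i₀ + rest) * suc c + suc c
                sizes = solve-∀
        tailX = slice (2 * i₀ * B + B + 1) tail-fits
        tailX∈Xⁱ⁺ : ∀ t → InXFrom k B (pos i) (pos (tailX t))
        tailX∈Xⁱ⁺ t = InXFrom-tail k B (toℕ<n i)
          (subst₂ _≤_ (cong (_+ 2) (sym (2[1+j]B∸B k B i₀))) (cong suc (sym (toℕ-slice _ tail-fits t)))
             (≤-trans (≤-reflexive (+-suc _ 1)) (s≤s (m≤m+n _ (toℕ t)))))
          (toℕ<n (tailX t))

      upper : ∀ s u → place (d s i u) ≤ e + 2 * k * B + 2 * pos i * B
      upper s u = +-cancelˡ-≤ cnt _ _ (begin
        cnt + place (d s i u)  ≤⟨ +-monoʳ-≤ cnt (near-ℓ s u) ⟩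
        cnt + (place ℓ + b)    ≡⟨ +-assoc cnt (place ℓ) b ⟨
        cnt + place ℓ + b      ≤⟨ +-monoˡ-≤ b tailX-count ⟩
        suc (e + b) + b        ≡⟨ subst (λ K → suc (e + (2 * K * B + c)) + (2 * K * B + c)
                                               ≡ 2 * rest * B + B + c + (e + 2 * K * B + 2 * suc i₀ * B))
                                        1+i₀+rest≡k (sizes e i₀ rest c) ⟩
        cnt + (e + 2 * k * B + 2 * pos i * B) ∎)
        where
        open ≤-Reasoning
        cnt = 2 * rest * B + B + c
        sizes : ∀ e i₀ rest c → suc (e + (2 * (suc i₀ + rest) * suc c + c)) + (2 * (suc i₀ + rest) * suc c + c)
                                ≡ 2 * rest * suc c + suc c + c + (e + 2 * (suc i₀ + rest) * suc c + 2 * suc i₀ * suc c)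
        sizes = solve-∀

      -- r^i_B is adjacent to the 2iB + c vertices of Y^1 ∪ … ∪ Y^i, all placed at or after q.
      headY-count : 2 * pos i * B + c + q ≤ suc (place r + b)
      headY-count = injective-bounded⇒count+lo≤hi (λ t → place (y (headY t)))
        (λ eq → slice-injective 0 head-fits (y-injective (place-injective eq)))
        (λ t → Y.start≤ (headY t) , s≤s (edge-≤ (rBy i lastB (headY t) pos-lastB (headY∈Y≤ⁱ t))))
        (≤-trans q≤r+b (n≤1+n _))
        where
        head-fits : 0 + (2 * pos i * B + c) ≤ S
        head-fits = ≤-trans (+-monoˡ-≤ c (*-monoˡ-≤ B (*-monoʳ-≤ 2 (toℕ<n i)))) (+-monoʳ-≤ (2 * k * B) (n≤1+n c))
        headY = slice 0 head-fits
        headY∈Y≤ⁱ : ∀ t → InYUpTo k B (pos i) (pos (headY t))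
        headY∈Y≤ⁱ t = InYUpTo-head k B (s≤s z≤n) (s≤s z≤n)
          (subst₂ _≤_ (cong suc (sym (toℕ-slice 0 head-fits t))) (cong (_∸ 1) (sym (+-suc _ c))) (toℕ<n t))

      lower : ∀ s u → e + 2 * i₀ * B + B < place (d s i u)
      lower s u = ≤-pred (+-cancelʳ-≤ (b + b) _ _ (begin
        suc (suc (e + 2 * i₀ * B + B)) + (b + b) ≡⟨ sizes e i₀ k′ c ⟩
        2 * pos i * B + c + suc (e + 4 * k * B)  ≤⟨ +-monoʳ-≤ _ gap ⟩
        2 * pos i * B + c + q                    ≤⟨ headY-count ⟩
        suc (place r + b)                        ≤⟨ s≤s (+-monoˡ-≤ b (near-r s u)) ⟩
        suc (place (d s i u) + b + b)            ≡⟨ cong suc (+-assoc _ b b) ⟩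
        suc (place (d s i u)) + (b + b)          ∎))
        where
        open ≤-Reasoning
        sizes : ∀ e i₀ k′ c → suc (suc (e + 2 * i₀ * suc c + suc c)) + ((2 * suc k′ * suc c + c) + (2 * suc k′ * suc c + c))
                              ≡ 2 * suc i₀ * suc c + c + suc (e + 4 * suc k′ * suc c)
        sizes = solve-∀

    -- Item j lies in one of the first t bins when one of its left vertices is placed at or before e + 2(t-1)B + B.
    firstBins : ℕ → Fin n → Bool
    firstBins zero     j = false
    firstBins (suc t₀) j = does (any? λ r → place (it left j r) ≤? e + 2 * t₀ * B + B)

    firstBins-increasing : ∀ j → Increasing (λ t → firstBins t j)
    firstBins-increasing j (suc t₀) in-first =
      let (r , r≤) = does⇒ (any? λ r → place (it left j r) ≤? e + 2 * t₀ * B + B) in-first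
      in dec-true (any? λ r → place (it left j r) ≤? e + 2 * suc t₀ * B + B)
                  (r , ≤-trans r≤ (+-monoˡ-≤ B (+-monoʳ-≤ e (*-monoˡ-≤ B (*-monoʳ-≤ 2 (n≤1+n t₀))))))

    q<N : q < N
    q<N = place<N (y Y.lowest)

    module Bin (t₀ : ℕ) (1+t₀<k : suc t₀ < k) where

      -- With k = t₀ + 2 + m′ the comparisons below become polynomial identities.
      m′ : ℕ
      m′ = proj₁ (m≤n⇒∃[o]m+o≡n 1+t₀<k)

      2+t₀+m′≡k : suc (suc t₀) + m′ ≡ k
      2+t₀+m′≡k = proj₂ (m≤n⇒∃[o]m+o≡n 1+t₀<k)

      α β : ℕ
      α = e + 2 * t₀ * B + B
      β = e + 2 * k * B + 2 * suc t₀ * B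

      lastBins : Fin n → Bool
      lastBins j = does (any? λ r → β <? place (it right j r))

      1+α+b≡β : suc (α + b) ≡ β
      1+α+b≡β = sizes e t₀ k′ c
        where sizes : ∀ e t₀ k′ c → suc (e + 2 * t₀ * suc c + suc c + (2 * suc k′ * suc c + c))
                                    ≡ e + 2 * suc k′ * suc c + 2 * suc t₀ * suc c
              sizes = solve-∀

      α+b+2[1+m′]B≡e+4kB : suc (α + b) + 2 * suc m′ * B ≡ e + 4 * k * B
      α+b+2[1+m′]B≡e+4kB =
        subst (λ K → suc (e + 2 * t₀ * B + B + (2 * K * B + c)) + 2 * suc m′ * B ≡ e + 4 * K * B) 2+t₀+m′≡k
          (sizes e t₀ m′ c)
        where sizes : ∀ e t₀ m′ c → suc (e + 2 * t₀ * suc c + suc c + (2 * (suc (suc t₀) + m′) * suc c + c))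
                                    + 2 * suc m′ * suc c
                                    ≡ e + 4 * (suc (suc t₀) + m′) * suc c
              sizes = solve-∀

      β+2[1+m′]B≡e+4kB : β + 2 * suc m′ * B ≡ e + 4 * k * B
      β+2[1+m′]B≡e+4kB =
        subst (λ K → e + 2 * K * B + 2 * suc t₀ * B + 2 * suc m′ * B ≡ e + 4 * K * B) 2+t₀+m′≡k (sizes e t₀ m′ c)
        where sizes : ∀ e t₀ m′ c → e + 2 * (suc (suc t₀) + m′) * suc c + 2 * suc t₀ * suc c + 2 * suc m′ * suc c
                                    ≡ e + 4 * (suc (suc t₀) + m′) * suc c
              sizes = solve-∀

      α+b<q : α + b < q
      α+b<q = ≤-trans (m≤m+n (suc (α + b)) _) (≤-trans (≤-reflexive α+b+2[1+m′]B≡e+4kB) (<⇒≤ gap))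

      late-window≤q : suc β + 2 * suc m′ * B ≤ q
      late-window≤q = subst (λ w → suc w ≤ q) (sym β+2[1+m′]B≡e+4kB) gap

      e+b≤β : e + b ≤ β
      e+b≤β = ≤-trans (+-monoˡ-≤ b (≤-trans (m≤m+n e _) (m≤m+n _ B))) (≤-trans (n≤1+n _) (≤-reflexive 1+α+b≡β))

      earlyDelimiters earlyItems lateDelimiters lateItems : List V
      earlyDelimiters = delimiters (λ i → toℕ i <? t₀) left
      earlyItems      = selected (firstBins (suc t₀)) left
      lateDelimiters  = delimiters (λ i → suc t₀ ≤? toℕ i) right
      lateItems       = selected lastBins right

      early : ∀ v → e < place v → place v ≤ α → place v ∈ map place (earlyDelimiters ++ earlyItems)
      early (x m)          e<v _   = ⊥-elim (<⇒≱ e<v (X.≤start+b m))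
      early (y m)          _   v≤α = ⊥-elim (<⇒≱ (≤-<-trans v≤α (≤-<-trans (m≤m+n α b) α+b<q)) (Y.start≤ m))
      early (d left i u)   _   v≤α with toℕ i <? t₀
      ... | yes i<t₀ = ∈-map⁺ place (∈-++⁺ˡ (∈-delimiters⁺ (λ i → toℕ i <? t₀) u i<t₀))
      ... | no  i≮t₀ = ⊥-elim (<⇒≱ (DelimiterWindow.lower i left u)
                                   (≤-trans v≤α (+-monoˡ-≤ B (+-monoʳ-≤ e (*-monoˡ-≤ B (*-monoʳ-≤ 2 (≮⇒≥ i≮t₀)))))))
      early (d right i u)  _   v≤α = ⊥-elim (<⇒≱ α+b<q (≤-trans (q≤delimiterʳ+b i u) (+-monoˡ-≤ b v≤α)))
      early (it left j r)  _   v≤α =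
        ∈-map⁺ place (∈-++⁺ʳ earlyDelimiters (∈-selected⁺ r (dec-true (any? λ r → place (it left j r) ≤? α) (r , v≤α))))
      early (it right j r) _   v≤α = ⊥-elim (<⇒≱ α+b<q (≤-trans (q≤itemʳ+b j r) (+-monoˡ-≤ b v≤α)))

      late : ∀ v → β < place v → place v < suc β + 2 * suc m′ * B → place v ∈ map place (lateDelimiters ++ lateItems)
      late (x m)          β<v _   = ⊥-elim (<⇒≱ β<v (≤-trans (X.≤start+b m) (≤-trans (m≤m+n e b) e+b≤β)))
      late (y m)          _   v<  = ⊥-elim (<⇒≱ (<-≤-trans v< late-window≤q) (Y.start≤ m))
      late (d left i u)   β<v _   = ⊥-elim (<⇒≱ β<v (≤-trans (delimiterˡ≤e+b i u) e+b≤β))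
      late (d right i u)  β<v _   with suc t₀ ≤? toℕ i
      ... | yes t₀<i = ∈-map⁺ place (∈-++⁺ˡ (∈-delimiters⁺ (λ i → suc t₀ ≤? toℕ i) u t₀<i))
      ... | no  t₀≮i = ⊥-elim (<⇒≱ β<v (≤-trans (DelimiterWindow.upper i right u)
                                          (+-monoʳ-≤ (e + 2 * k * B) (*-monoˡ-≤ B (*-monoʳ-≤ 2 (≰⇒> t₀≮i))))))
      late (it left j r)  β<v _   = ⊥-elim (<⇒≱ β<v (≤-trans (itemˡ≤e+b j r) e+b≤β))
      late (it right j r) β<v _   =
        ∈-map⁺ place (∈-++⁺ʳ lateDelimiters (∈-selected⁺ r (dec-true (any? λ r → β <? place (it right j r)) (r , β<v))))

      early-count : suc t₀ * B ≤ weight a (firstBins (suc t₀))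
      early-count = +-cancelˡ-≤ (t₀ * B) _ _ (begin
        t₀ * B + suc t₀ * B                         ≡⟨ rearrange t₀ c ⟩
        2 * t₀ * B + B                              ≤⟨ interval-⊆-map⇒length≤ place window ⟩
        length (earlyDelimiters ++ earlyItems)      ≡⟨ length-++ earlyDelimiters ⟩
        length earlyDelimiters + length earlyItems  ≤⟨ +-mono-≤ few-early-delimiters
                                                                (≤-reflexive (length-selected _ left)) ⟩
        t₀ * B + weight a (firstBins (suc t₀))      ∎)
        where
        open ≤-Reasoning
        rearrange : ∀ t₀ c → t₀ * suc c + suc t₀ * suc c ≡ 2 * t₀ * suc c + suc c
        rearrange = solve-∀
        window : interval (suc e) (2 * t₀ * B + B) ⊆ map place (earlyDelimiters ++ earlyItems)
        window = interval-occupied L (≤-trans (subst (_≤ suc (α + b)) (+-assoc (suc e) _ B) (s≤s (m≤m+n α b)))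
                                              (<-trans α+b<q q<N))
                   λ v e<v v<α+1 → early v e<v (≤-pred (subst (place v <_) (sym (+-assoc (suc e) _ B)) v<α+1))
        few-early-delimiters : length earlyDelimiters ≤ t₀ * B
        few-early-delimiters = subst (_≤ t₀ * B) (sym (length-delimiters (λ i → toℕ i <? t₀) left))
          (*-monoˡ-≤ B (subst (_≤ t₀) (+-identityʳ (length (filter (λ i → toℕ i <? t₀) (allFin k))))
            (length-filter-allFin-bounded {k} (λ i → toℕ i <? t₀) (λ i i<t₀ → z≤n , i<t₀) z≤n)))

      late-count : suc m′ * B ≤ weight a lastBins
      late-count = +-cancelˡ-≤ (suc m′ * B) _ _ (begin
        suc m′ * B + suc m′ * B                   ≡⟨ double m′ c ⟩
        2 * suc m′ * B                            ≤⟨ interval-⊆-map⇒length≤ place window ⟩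
        length (lateDelimiters ++ lateItems)      ≡⟨ length-++ lateDelimiters ⟩
        length lateDelimiters + length lateItems  ≤⟨ +-mono-≤ few-late-delimiters
                                                              (≤-reflexive (length-selected lastBins right)) ⟩
        suc m′ * B + weight a lastBins            ∎)
        where
        open ≤-Reasoning
        double : ∀ m′ c → suc m′ * suc c + suc m′ * suc c ≡ 2 * suc m′ * suc c
        double = solve-∀
        window : interval (suc β) (2 * suc m′ * B) ⊆ map place (lateDelimiters ++ lateItems)
        window = interval-occupied L (≤-trans late-window≤q (<⇒≤ q<N)) late
        few-late-delimiters : length lateDelimiters ≤ suc m′ * B
        few-late-delimiters = subst (_≤ suc m′ * B) (sym (length-delimiters (λ i → suc t₀ ≤? toℕ i) right))
          (*-monoˡ-≤ B (+-cancelʳ-≤ (suc t₀) _ _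
            (subst (length (filter (λ i → suc t₀ ≤? toℕ i) (allFin k)) + suc t₀ ≤_)
                   (trans (sym 2+t₀+m′≡k) (cong suc (+-comm (suc t₀) m′)))
              (length-filter-allFin-bounded {k} (λ i → suc t₀ ≤? toℕ i) (λ i t₀<i → t₀<i , toℕ<n i) (<⇒≤ 1+t₀<k)))))

      first-last-disjoint : ∀ j → firstBins (suc t₀) j ≡ true → lastBins j ≡ true → ⊥
      first-last-disjoint j in-first in-last =
        let (r , r≤α) = does⇒ (any? λ r → place (it left j r) ≤? α) in-first
            (r′ , β<r′) = does⇒ (any? λ r → β <? place (it right j r)) in-last
        in <⇒≱ β<r′ (≤-trans (edge-≤ (aa j left right r r′ λ ()))
                              (≤-trans (+-monoˡ-≤ b r≤α) (≤-trans (n≤1+n _) (≤-reflexive 1+α+b≡β))))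

      weight-firstBins : weight a (firstBins (suc t₀)) ≡ suc t₀ * B
      weight-firstBins = ≤-antisym (+-cancelʳ-≤ (suc m′ * B) _ _ (begin
        weight a (firstBins (suc t₀)) + suc m′ * B          ≤⟨ +-monoʳ-≤ _ late-count ⟩
        weight a (firstBins (suc t₀)) + weight a lastBins   ≤⟨ weight-disjoint-≤ a first-last-disjoint ⟩
        total n a                                           ≡⟨ total≡ ⟩
        k * B                                               ≡⟨ cong (_* B) (sym 2+t₀+m′≡k) ⟩
        (suc (suc t₀) + m′) * B                             ≡⟨ +-*-suc-split t₀ m′ B ⟩
        suc t₀ * B + suc m′ * B                             ∎)) early-count
        where
        open ≤-Reasoning
        +-*-suc-split : ∀ t₀ m′ B → (suc (suc t₀) + m′) * B ≡ suc t₀ * B + suc m′ * B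
        +-*-suc-split = solve-∀

    binPacking : BinPackingYes n a k
    binPacking = chain⇒BinPackingYes a k′ B firstBins total≡ firstBins-increasing
                   λ { (suc t₀) _ 1+t₀<k → Bin.weight-firstBins t₀ 1+t₀<k }

  layout⇒binPacking : total n a ≡ k * B → Layout E b → BinPackingYes n a k
  layout⇒binPacking total≡ L with <-cmp (Layout.place L (x zero)) (Layout.place L (y zero))
  ... | tri< x₁<y₁ _ _ = Oriented.binPacking total≡ L x₁<y₁
  ... | tri> _ _ y₁<x₁ = Oriented.binPacking total≡ (reverse L) (reverse-< L y₁<x₁)
  ... | tri≈ _ x₁≡y₁ _ with Layout.place-injective L x₁≡y₁
  ...   | ()

lemma15 : (n : ℕ) (a : Fin n → ℕ) (k B : ℕ) →
          1 ≤ k → total n a ≡ k * B →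
          BandwidthYes (Vtx n a k B) (Edge n a k B) (bound k B) →
          BinPackingYes n a k
lemma15 n a (suc k′) zero    _ total≡ _ =
  chain⇒BinPackingYes a k′ 0 (λ _ _ → false) total≡ (λ _ _ ())
    (λ t _ _ → trans (sum-map-const 0 (allFin n)) (trans (*-zeroʳ (length (allFin n))) (sym (*-zeroʳ t))))
lemma15 n a (suc k′) (suc c) _ total≡ bandwidth =
  layout⇒binPacking total≡ (BandwidthYes⇒Layout (subst (BandwidthYes V E) bound≡b bandwidth))
  where open Construction n a k′ c
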